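{- Let $K$ be a complete discretely valued field with ring of integers $\mathcal{O}_K$ and uniformiser $\pi$. Let $g\in M_2(\mathcal{O}_K)$ and let $x$ be a boundary point of $\mathcal{X}(\{g\})$, with representative lattice $\Lambda_x$. Let $n\ge1$ and assume that the characteristic polynomial $P_g(t)=\det(t-g)$ factors as $P_g(t)\equiv(t-\alpha)(t-\beta)\pmod{\pi^n}$ for some $\alpha,\beta\in\mathcal{O}_K/\pi^n\mathcal{O}_K$. Then there exists a basis $(v_1,v_2)$ of $\Lambda_x/\pi^n\Lambda_x$ with respect to which $g \bmod \pi^n$ is represented by the matrix $\begin{pmatrix}\alpha&1\\0&\beta\end{pmatrix}$.
   Context: A lattice is a free rank-$2$ $\mathcal{O}_K$-submodule of $K^2$ spanning $K^2$. The Bruhat--Tits tree $\mathcal{X}$ has vertices the homothety classes of lattices, two classes being adjacent if they have representatives with $\pi\Lambda_x\subsetneq\Lambda_y\subsetneq\Lambda_x$. For a set $A$ of matrices, $\mathcal{X}(A)$ is the set of vertices $x$ with $a\Lambda_x\subseteq\Lambda_x$ for all $a\in A$. For a subset $U\subseteq\mathcal{X}$, a vertex $x\in U$ is a boundary point of $U$ if the ball $B(x,1)$ (the vertices at distance at most $1$ from $x$) is not contained in $U$. -}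

module Defs where

open import Level using (Level; _⊔_; 0ℓ) renaming (suc to lsuc)
open import Algebra.Bundles using (CommutativeRing)
open import Data.Integer as ℤ using (ℤ; +_)
open import Data.Maybe using (Maybe; just; nothing)
open import Data.Nat as ℕ using (ℕ; zero; suc)
open import Data.Product using (Σ; ∃; _×_; _,_)
open import Relation.Binary.PropositionalEquality using (_≡_)
open import Relation.Nullary using (¬_)

-- A complete discretely valued field K with normalised discrete
-- valuation v : K → ℤ ∪ {∞} (∞ encoded as nothing) and uniformiser π.

record CDVF (c ℓ : Level) : Set (lsuc (c ⊔ ℓ)) where
  field
    cring : CommutativeRing c ℓ
  open CommutativeRing cring public
  field
    1≉0     : ¬ (1# ≈ 0#)
    inverse : ∀ x → ¬ (x ≈ 0#) → ∃ λ y → x * y ≈ 1#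
    v       : Carrier → Maybe ℤ
    v-resp  : ∀ {x y} → x ≈ y → v x ≡ v y
    v-0     : v 0# ≡ nothing
    v-∞     : ∀ x → v x ≡ nothing → x ≈ 0#
    v-mul   : ∀ x y m n → v x ≡ just m → v y ≡ just n →
              v (x * y) ≡ just (m ℤ.+ n)
    v-add   : ∀ x y m n k → v x ≡ just m → v y ≡ just n →
              v (x + y) ≡ just k → (m ℤ.⊓ n) ℤ.≤ k
    π       : Carrier
    v-π     : v π ≡ just (+ 1)
    complete : (s : ℕ → Carrier) →
      (∀ (N : ℕ) → ∃ λ M → ∀ i j → M ℕ.≤ i → M ℕ.≤ j →
         ∀ k → v (s i + (- s j)) ≡ just k → (+ N) ℤ.≤ k) →
      ∃ λ L → ∀ (N : ℕ) → ∃ λ M → ∀ i → M ℕ.≤ i →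
         ∀ k → v (s i + (- L)) ≡ just k → (+ N) ℤ.≤ k

module Notions {c ℓ : Level} (F : CDVF c ℓ) where
  open CDVF F public

  K : Set c
  K = Carrier

  vge : K → ℤ → Set
  vge x n = ∀ k → v x ≡ just k → n ℤ.≤ k

  O : K → Set
  O x = vge x (+ 0)

  _≡[mod_]_ : K → ℕ → K → Set
  x ≡[mod n ] y = vge (x + (- y)) (+ n)

  _^_ : K → ℕ → K
  x ^ zero  = 1#
  x ^ suc n = x * (x ^ n)

  K2 : Set c
  K2 = K × K

  _≈2_ : K2 → K2 → Set ℓ
  (a , b) ≈2 (a' , b') = (a ≈ a') × (b ≈ b')

  _+2_ : K2 → K2 → K2
  (a , b) +2 (a' , b') = (a + a' , b + b')

  neg2 : K2 → K2
  neg2 (a , b) = (- a , - b)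

  _·_ : K → K2 → K2
  t · (a , b) = (t * a , t * b)

  zero2 : K2
  zero2 = (0# , 0#)

  record Mat2 : Set c where
    constructor mat
    field a b c' d : K

  _⊙_ : Mat2 → K2 → K2
  mat a b c' d ⊙ (x , y) = (a * x + b * y , c' * x + d * y)

  trace : Mat2 → K
  trace (mat a b c' d) = a + d

  det : Mat2 → K
  det (mat a b c' d) = a * d + (- (b * c'))

  IntegralMat : Mat2 → Set
  IntegralMat (mat a b c' d) = O a × O b × O c' × O d

  record Lattice : Set (lsuc (c ⊔ ℓ)) where
    field
      mem    : K2 → Set (c ⊔ ℓ)
      resp   : ∀ {w w'} → w ≈2 w' → mem w → mem w'
      e₁ e₂  : K2
      gen    : ∀ w → mem w → ∃ λ a → ∃ λ b → O a × O b × (w ≈2 ((a · e₁) +2 (b · e₂)))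
      gen⁻¹  : ∀ a b → O a → O b → mem ((a · e₁) +2 (b · e₂))
      free   : ∀ a b → O a → O b → ((a · e₁) +2 (b · e₂)) ≈2 zero2 → (a ≈ 0#) × (b ≈ 0#)
      span   : ∀ (w : K2) → ∃ λ a → ∃ λ b → w ≈2 ((a · e₁) +2 (b · e₂))
  open Lattice public

  _∈[_·_] : K2 → K → Lattice → Set (c ⊔ ℓ)
  w ∈[ t · Λ ] = ∃ λ u → mem Λ u × (w ≈2 (t · u))

  Sub : K → Lattice → K → Lattice → Set (c ⊔ ℓ)
  Sub t Λ s M = ∀ w → w ∈[ t · Λ ] → w ∈[ s · M ]

  SSub : K → Lattice → K → Lattice → Set (c ⊔ ℓ)
  SSub t Λ s M = Sub t Λ s M × ∃ λ w → w ∈[ s · M ] × ¬ (w ∈[ t · Λ ])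

  -- adjacency of the vertices [Λ], [M] of the Bruhat–Tits tree:
  -- representatives cΛ, dM (c, d ∈ K^×) with π(cΛ) ⊊ dM ⊊ cΛ
  Adjacent : Lattice → Lattice → Set (c ⊔ ℓ)
  Adjacent Λ M = ∃ λ c₀ → ∃ λ d₀ → ¬ (c₀ ≈ 0#) × ¬ (d₀ ≈ 0#) ×
                 SSub (π * c₀) Λ d₀ M × SSub d₀ M c₀ Λ

  -- [Λ] ∈ 𝒳({g}) : g Λ ⊆ Λ (independent of the representative)
  InX : Mat2 → Lattice → Set (c ⊔ ℓ)
  InX g Λ = ∀ w → mem Λ w → mem Λ (g ⊙ w)

  InBall1 : Lattice → Lattice → Set (c ⊔ ℓ)
  InBall1 Λ M = (∃ λ t → ¬ (t ≈ 0#) × Sub 1# M t Λ × Sub t Λ 1# M) ⊎' Adjacent Λ M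
    where
    open import Data.Sum using () renaming (_⊎_ to _⊎'_)

  BoundaryPoint : Mat2 → Lattice → Set (lsuc (c ⊔ ℓ))
  BoundaryPoint g Λ = InX g Λ × ∃ λ (M : Lattice) → InBall1 Λ M × ¬ InX g M

  _≡[_mod_]_ : K2 → Lattice → ℕ → K2 → Set (c ⊔ ℓ)
  w ≡[ Λ mod n ] w' = (w +2 (neg2 w')) ∈[ (π ^ n) · Λ ]

  -- v₁, v₂ ∈ Λ whose images form a basis of the 𝒪_K/π^n-module Λ/π^nΛ
  QuotBasis : Lattice → ℕ → K2 → K2 → Set (c ⊔ ℓ)
  QuotBasis Λ n v₁ v₂ =
    mem Λ v₁ × mem Λ v₂ ×
    (∀ w → mem Λ w → ∃ λ a → ∃ λ b → O a × O b ×
         (w ≡[ Λ mod n ] ((a · v₁) +2 (b · v₂)))) ×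
    (∀ a b → O a → O b → (((a · v₁) +2 (b · v₂)) ≡[ Λ mod n ] zero2) →
         (a ≡[mod n ] 0#) × (b ≡[mod n ] 0#))

-- Write g in a basis of Λ as an integral matrix G. If G were congruent to a scalar p modulo π,
-- then g = p + πh with hΛ ⊆ Λ, and such a g preserves every lattice M with πcΛ ⊆ dM ⊆ cΛ,
-- hence every vertex of B([Λ], 1); so at a boundary point one of e₁, e₂, e₁ + e₂ is a cyclic
-- vector x, i.e. det(Gx, x) is a unit. Take v₂ = x and v₁ = (g − β)v₂. Then gv₂ = v₁ + βv₂
-- exactly, (v₁, v₂) is a basis of Λ since its determinant is det(Gx, x), and by Cayley–Hamilton
-- (g − α)v₁ = (tr g − α − β)gv₂ − (det g − αβ)v₂ ∈ πⁿΛ.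
module Submission where

open import Defs
open import Level using (Level; _⊔_)
open import Algebra.Bundles using (CommutativeRing; AbelianGroup)
open import Algebra.Solver.Ring.AlmostCommutativeRing using (_-Raw-AlmostCommutative⟶_; fromCommutativeRing)
open import Data.Nat as ℕ using (ℕ; zero; suc; z≤n; s≤s)
import Data.Nat.Properties as ℕP
open import Data.Integer as ℤ using (ℤ; +_; -[1+_]; +≤+)
import Data.Integer.Properties as ℤP
open import Data.Sign as Sign using ()
open import Data.Maybe as Maybe using (Maybe; just; nothing)
open import Data.Maybe.Properties using (just-injective)
open import Data.Product using (∃; _×_; _,_; proj₁; proj₂)
open import Data.Product.Relation.Binary.Pointwise.NonDependent using (×-setoid)
open import Data.Sum using (_⊎_; inj₁; inj₂)
open import Data.Empty using (⊥-elim)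
open import Relation.Binary.Bundles using (Setoid)
import Relation.Binary.Reasoning.Setoid as SetoidReasoning
open import Relation.Binary.PropositionalEquality as P using (_≡_)
open import Relation.Nullary using (¬_)
open import Relation.Nullary.Decidable using (dec⇒maybe)
open import Algebra.Properties.Group (AbelianGroup.group ℤP.+-0-abelianGroup)
  using (identityˡ-unique; inverseʳ-unique)

-- The ring solver of the standard library needs a coefficient ring with decidable equality;
-- ℤ maps into every commutative ring.
module ℤ-CoefficientSolver {c ℓ : Level} (R : CommutativeRing c ℓ) where
  open CommutativeRing R
  open import Algebra.Properties.Ring ring using (-‿involutive; -‿distribˡ-*; -‿distribʳ-*; -‿+-comm; -0#≈0#)
  open import Algebra.Properties.Semiring.Mult.TCOptimised semiring
    using (1+×; ×-homo-+; ×1-homo-*) renaming (_×_ to _×′_)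
  open SetoidReasoning setoid

  -- With the optimised multiple _×′_, fromℤ (+ 1) and fromℤ (+ 0) reduce to 1# and 0#,
  -- so con (+ 1) and con (+ 0) match 1# and 0# in solver goals.
  fromℤ : ℤ → Carrier
  fromℤ (+ n) = n ×′ 1#
  fromℤ -[1+ n ] = - (suc n ×′ 1#)

  private
    ⊖-homo : ∀ m n → fromℤ (m ℤ.⊖ n) ≈ m ×′ 1# + - (n ×′ 1#)
    ⊖-homo zero zero = sym (trans (+-congˡ -0#≈0#) (+-identityʳ _))
    ⊖-homo zero (suc n) = sym (+-identityˡ _)
    ⊖-homo (suc m) zero = sym (trans (+-congˡ -0#≈0#) (+-identityʳ _))
    ⊖-homo (suc m) (suc n) = begin
      fromℤ (suc m ℤ.⊖ suc n)                  ≡⟨ P.cong fromℤ (ℤP.[1+m]⊖[1+n]≡m⊖n m n) ⟩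
      fromℤ (m ℤ.⊖ n)                          ≈⟨ ⊖-homo m n ⟩
      m ×′ 1# + - (n ×′ 1#)                    ≈⟨ +-congʳ (+-identityˡ _) ⟨
      (0# + m ×′ 1#) + - (n ×′ 1#)             ≈⟨ +-congʳ (+-congʳ (-‿inverseʳ 1#)) ⟨
      ((1# + - 1#) + m ×′ 1#) + - (n ×′ 1#)    ≈⟨ +-congʳ (+-assoc _ _ _) ⟩
      (1# + (- 1# + m ×′ 1#)) + - (n ×′ 1#)    ≈⟨ +-congʳ (+-congˡ (+-comm _ _)) ⟩
      (1# + (m ×′ 1# + - 1#)) + - (n ×′ 1#)    ≈⟨ +-congʳ (+-assoc _ _ _) ⟨
      ((1# + m ×′ 1#) + - 1#) + - (n ×′ 1#)    ≈⟨ +-assoc _ _ _ ⟩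
      (1# + m ×′ 1#) + (- 1# + - (n ×′ 1#))    ≈⟨ +-congˡ (-‿+-comm _ _) ⟩
      (1# + m ×′ 1#) + - (1# + n ×′ 1#)        ≈⟨ +-cong (1+× m 1#) (-‿cong (1+× n 1#)) ⟨
      suc m ×′ 1# + - (suc n ×′ 1#)            ∎

    +-homo : ∀ i j → fromℤ (i ℤ.+ j) ≈ fromℤ i + fromℤ j
    +-homo -[1+ m ] -[1+ n ] = begin
      - (suc (suc (m ℕ.+ n)) ×′ 1#)        ≡⟨ P.cong (λ k → - (k ×′ 1#)) (P.sym (ℕP.+-suc (suc m) n)) ⟩
      - ((suc m ℕ.+ suc n) ×′ 1#)          ≈⟨ -‿cong (×-homo-+ 1# (suc m) (suc n)) ⟩
      - (suc m ×′ 1# + suc n ×′ 1#)        ≈⟨ -‿+-comm _ _ ⟨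
      - (suc m ×′ 1#) + - (suc n ×′ 1#)    ∎
    +-homo -[1+ m ] (+ n) = trans (⊖-homo n (suc m)) (+-comm _ _)
    +-homo (+ m) -[1+ n ] = ⊖-homo m (suc n)
    +-homo (+ m) (+ n) = ×-homo-+ 1# m n

    -‿homo : ∀ i → fromℤ (ℤ.- i) ≈ - fromℤ i
    -‿homo (+ zero) = sym -0#≈0#
    -‿homo (+ suc n) = refl
    -‿homo -[1+ n ] = sym (-‿involutive _)

    -◃-homo : ∀ n → fromℤ (Sign.- ℤ.◃ n) ≈ - (n ×′ 1#)
    -◃-homo zero = sym -0#≈0#
    -◃-homo (suc n) = refl

    +◃-homo : ∀ n → fromℤ (Sign.+ ℤ.◃ n) ≈ n ×′ 1#
    +◃-homo zero = refl
    +◃-homo (suc n) = refl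

    *-homo : ∀ i j → fromℤ (i ℤ.* j) ≈ fromℤ i * fromℤ j
    *-homo (+ m) (+ n) = trans (+◃-homo (m ℕ.* n)) (×1-homo-* m n)
    *-homo (+ m) -[1+ n ] = begin
      fromℤ (Sign.- ℤ.◃ (m ℕ.* suc n))      ≈⟨ -◃-homo (m ℕ.* suc n) ⟩
      - ((m ℕ.* suc n) ×′ 1#)               ≈⟨ -‿cong (×1-homo-* m (suc n)) ⟩
      - (m ×′ 1# * suc n ×′ 1#)             ≈⟨ -‿distribʳ-* _ _ ⟩
      m ×′ 1# * - (suc n ×′ 1#)             ∎
    *-homo -[1+ m ] (+ n) = begin
      fromℤ (Sign.- ℤ.◃ (suc m ℕ.* n))      ≈⟨ -◃-homo (suc m ℕ.* n) ⟩
      - ((suc m ℕ.* n) ×′ 1#)               ≈⟨ -‿cong (×1-homo-* (suc m) n) ⟩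
      - (suc m ×′ 1# * n ×′ 1#)             ≈⟨ -‿distribˡ-* _ _ ⟩
      - (suc m ×′ 1#) * n ×′ 1#             ∎
    *-homo -[1+ m ] -[1+ n ] = begin
      fromℤ (Sign.+ ℤ.◃ (suc m ℕ.* suc n))  ≈⟨ +◃-homo (suc m ℕ.* suc n) ⟩
      (suc m ℕ.* suc n) ×′ 1#               ≈⟨ ×1-homo-* (suc m) (suc n) ⟩
      suc m ×′ 1# * suc n ×′ 1#             ≈⟨ -‿involutive _ ⟨
      - - (suc m ×′ 1# * suc n ×′ 1#)       ≈⟨ -‿cong (-‿distribˡ-* _ _) ⟩
      - (- (suc m ×′ 1#) * suc n ×′ 1#)     ≈⟨ -‿distribʳ-* _ _ ⟩
      - (suc m ×′ 1#) * - (suc n ×′ 1#)     ∎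

  fromℤ-morphism : CommutativeRing.rawRing ℤP.+-*-commutativeRing -Raw-AlmostCommutative⟶ fromCommutativeRing R
  fromℤ-morphism = record
    { ⟦_⟧ = fromℤ ; +-homo = +-homo ; *-homo = *-homo ; -‿homo = -‿homo
    ; 0-homo = refl ; 1-homo = refl }

  fromℤ-≟ : ∀ i j → Maybe (fromℤ i ≈ fromℤ j)
  fromℤ-≟ i j = Maybe.map (λ { P.refl → refl }) (dec⇒maybe (i ℤ.≟ j))

  open import Algebra.Solver.Ring (CommutativeRing.rawRing ℤP.+-*-commutativeRing)
    (fromCommutativeRing R) fromℤ-morphism fromℤ-≟ public

i+i≡0⇒i≡0 : ∀ i → i ℤ.+ i ≡ + 0 → i ≡ + 0
i+i≡0⇒i≡0 (+ zero) _ = P.refl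

module _ {c ℓ : Level} (F : CDVF c ℓ) where
  open Notions F
  open ℤ-CoefficientSolver cring using (solve; _:=_; _:+_; _:*_; :-_; con)
  open import Algebra.Properties.Group +-group using (x∙y⁻¹≈ε⇒x≈y)
  open import Algebra.Properties.Ring ring using (-‿distribʳ-*; -0#≈0#)

  -- Valuations

  Unit : K → Set
  Unit x = v x ≡ just (+ 0)

  v-cases : ∀ x → (v x ≡ nothing) ⊎ ∃ λ k → v x ≡ just k
  v-cases x with v x
  ... | nothing = inj₁ P.refl
  ... | just k = inj₂ (k , P.refl)

  v≡just⇒≉0 : ∀ {x k} → v x ≡ just k → ¬ (x ≈ 0#)
  v≡just⇒≉0 e x≈0 with P.trans (P.sym (P.trans (v-resp x≈0) v-0)) e
  ... | ()

  vge-resp : ∀ {x y n} → x ≈ y → vge x n → vge y n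
  vge-resp x≈y h k e = h k (P.trans (v-resp x≈y) e)

  vge-zero : ∀ {x n} → x ≈ 0# → vge x n
  vge-zero x≈0 k e = ⊥-elim (v≡just⇒≉0 e x≈0)

  vge-mono : ∀ {x m n} → m ℤ.≤ n → vge x n → vge x m
  vge-mono m≤n h k e = ℤP.≤-trans m≤n (h k e)

  v≡just⇒vge : ∀ {x k} → v x ≡ just k → vge x k
  v≡just⇒vge e j e′ = ℤP.≤-reflexive (just-injective (P.trans (P.sym e) e′))

  vge-+ : ∀ {x y n} → vge x n → vge y n → vge (x + y) n
  vge-+ {x} {y} hx hy k e with v-cases x | v-cases y
  ... | inj₁ ex | _ = hy k (P.trans (P.sym (v-resp (trans (+-congʳ (v-∞ x ex)) (+-identityˡ y)))) e)
  ... | inj₂ _ | inj₁ ey = hx k (P.trans (P.sym (v-resp (trans (+-congˡ (v-∞ y ey)) (+-identityʳ x)))) e)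
  ... | inj₂ (i , ex) | inj₂ (j , ey) = ℤP.≤-trans (ℤP.⊓-glb (hx i ex) (hy j ey)) (v-add x y i j k ex ey e)

  vge-* : ∀ {x y m n} → vge x m → vge y n → vge (x * y) (m ℤ.+ n)
  vge-* {x} {y} {m} {n} hx hy k e with v-cases x | v-cases y
  ... | inj₁ ex | _ = vge-zero (trans (*-congʳ (v-∞ x ex)) (zeroˡ y)) k e
  ... | inj₂ _ | inj₁ ey = vge-zero (trans (*-congˡ (v-∞ y ey)) (zeroʳ x)) k e
  ... | inj₂ (i , ex) | inj₂ (j , ey) =
    P.subst (m ℤ.+ n ℤ.≤_) (just-injective (P.trans (P.sym (v-mul x y i j ex ey)) e)) (ℤP.+-mono-≤ (hx i ex) (hy j ey))

  vge-*-O : ∀ {x y n} → vge x n → O y → vge (x * y) n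
  vge-*-O {x} {y} {n} hx Oy = P.subst (vge (x * y)) (ℤP.+-identityʳ n) (vge-* hx Oy)

  Unit-1# : Unit 1#
  Unit-1# with v-cases 1#
  ... | inj₁ e = ⊥-elim (1≉0 (v-∞ 1# e))
  ... | inj₂ (k , e) = P.trans e (P.cong just (identityˡ-unique k k
          (just-injective (P.trans (P.sym (v-mul 1# 1# k k e e)) (P.trans (v-resp (*-identityˡ 1#)) e)))))

  v-inverse : ∀ {y z k} → v y ≡ just k → y * z ≈ 1# → v z ≡ just (ℤ.- k)
  v-inverse {y} {z} {k} e yz≈1 with v-cases z
  ... | inj₁ ez = ⊥-elim (1≉0 (trans (sym yz≈1) (trans (*-congˡ (v-∞ z ez)) (zeroʳ y))))
  ... | inj₂ (j , ez) = P.trans ez (P.cong just (inverseʳ-unique k j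
          (just-injective (P.trans (P.sym (v-mul y z k j e ez)) (P.trans (v-resp yz≈1) Unit-1#)))))

  square≈1⇒Unit : ∀ {x} → x * x ≈ 1# → Unit x
  square≈1⇒Unit {x} xx≈1 with v-cases x
  ... | inj₁ e = ⊥-elim (1≉0 (trans (sym xx≈1) (trans (*-congʳ (v-∞ x e)) (zeroˡ x))))
  ... | inj₂ (k , e) = P.trans e (P.cong just (i+i≡0⇒i≡0 k
          (just-injective (P.trans (P.sym (v-mul x x k k e e)) (P.trans (v-resp xx≈1) Unit-1#)))))

  Unit-[-1] : Unit (- 1#)
  Unit-[-1] = square≈1⇒Unit (solve 0 (:- con (+ 1) :* :- con (+ 1) := con (+ 1)) refl)

  Unit-resp : ∀ {x y} → x ≈ y → Unit x → Unit y
  Unit-resp x≈y ux = P.trans (P.sym (v-resp x≈y)) ux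

  Unit-neg : ∀ {x} → Unit x → Unit (- x)
  Unit-neg {x} ux = Unit-resp (solve 1 (λ x → :- con (+ 1) :* x := :- x) refl x) (v-mul (- 1#) x (+ 0) (+ 0) Unit-[-1] ux)

  O-0# : O 0#
  O-0# = vge-zero refl

  O-1# : O 1#
  O-1# = v≡just⇒vge Unit-1#

  vge-neg : ∀ {x n} → vge x n → vge (- x) n
  vge-neg {x} {n} h = vge-resp (solve 1 (λ x → :- con (+ 1) :* x := :- x) refl x)
    (P.subst (vge (- 1# * x)) (ℤP.+-identityˡ n) (vge-* (v≡just⇒vge Unit-[-1]) h))

  v-π^ : ∀ n → v (π ^ n) ≡ just (+ n)
  v-π^ zero = Unit-1#
  v-π^ (suc n) = v-mul π (π ^ n) (+ 1) (+ n) v-π (v-π^ n)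

  O-π^ : ∀ n → O (π ^ n)
  O-π^ n = vge-mono (+≤+ z≤n) (v≡just⇒vge (v-π^ n))

  vge-π^-* : ∀ n {e} → O e → vge (π ^ n * e) (+ n)
  vge-π^-* n Oe = vge-*-O (v≡just⇒vge (v-π^ n)) Oe

  vge⇒π^-* : ∀ n {x} → vge x (+ n) → ∃ λ e → O e × (x ≈ π ^ n * e)
  vge⇒π^-* n {x} h with inverse (π ^ n) (v≡just⇒≉0 (v-π^ n))
  ... | i , π^i≈1 = i * x , O-ix , x≈π^ix
    where
    O-ix : O (i * x)
    O-ix = P.subst (vge (i * x)) (ℤP.+-inverseˡ (+ n)) (vge-* (v≡just⇒vge (v-inverse (v-π^ n) π^i≈1)) h)
    x≈π^ix : x ≈ π ^ n * (i * x)
    x≈π^ix = trans (sym (*-identityˡ x)) (trans (*-congʳ (sym π^i≈1)) (*-assoc _ _ _))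

  O⇒vge1⊎Unit : ∀ {x} → O x → vge x (+ 1) ⊎ Unit x
  O⇒vge1⊎Unit {x} Ox with v-cases x
  ... | inj₁ e = inj₁ (vge-zero (v-∞ x e))
  ... | inj₂ (+ zero , e) = inj₂ e
  ... | inj₂ (+ suc m , e) = inj₁ (vge-mono (+≤+ (s≤s z≤n)) (v≡just⇒vge e))
  ... | inj₂ (-[1+ m ] , e) with Ox _ e
  ...   | ()

  Unit⇒inverse : ∀ {x} → Unit x → ∃ λ y → O y × (x * y ≈ 1#)
  Unit⇒inverse {x} ux with inverse x (v≡just⇒≉0 ux)
  ... | y , xy≈1 = y , v≡just⇒vge (v-inverse ux xy≈1) , xy≈1

  Unit-+-vge1 : ∀ {u t} → Unit u → vge t (+ 1) → Unit (u + t)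
  Unit-+-vge1 {u} {t} uu ht with O⇒vge1⊎Unit (vge-+ (v≡just⇒vge uu) (vge-mono (+≤+ z≤n) ht))
  ... | inj₂ uu+t = uu+t
  ... | inj₁ h with vge-resp (solve 2 (λ u t → (u :+ t) :+ :- t := u) refl u t) (vge-+ h (vge-neg ht)) (+ 0) uu
  ...   | +≤+ ()

  -- Linear algebra in K²

  K2-setoid : Setoid c ℓ
  K2-setoid = ×-setoid setoid setoid

  open Setoid K2-setoid public using () renaming (refl to ≈2-refl; sym to ≈2-sym; trans to ≈2-trans)
  module ≈2-Reasoning = SetoidReasoning K2-setoid

  +2-cong : ∀ {u u′ w w′} → u ≈2 u′ → w ≈2 w′ → (u +2 w) ≈2 (u′ +2 w′)
  +2-cong (h₁ , h₂) (k₁ , k₂) = +-cong h₁ k₁ , +-cong h₂ k₂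

  neg2-cong : ∀ {u u′} → u ≈2 u′ → neg2 u ≈2 neg2 u′
  neg2-cong (h₁ , h₂) = -‿cong h₁ , -‿cong h₂

  ·-cong : ∀ {s t u u′} → s ≈ t → u ≈2 u′ → (s · u) ≈2 (t · u′)
  ·-cong s≈t (h₁ , h₂) = *-cong s≈t h₁ , *-cong s≈t h₂

  ⊙-congʳ : ∀ g {u u′} → u ≈2 u′ → (g ⊙ u) ≈2 (g ⊙ u′)
  ⊙-congʳ (mat a b c′ d) (h₁ , h₂) = +-cong (*-congˡ h₁) (*-congˡ h₂) , +-cong (*-congˡ h₁) (*-congˡ h₂)

  +2-inverseʳ : ∀ u → (u +2 neg2 u) ≈2 zero2
  +2-inverseʳ (u₁ , u₂) = -‿inverseʳ u₁ , -‿inverseʳ u₂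

  +2-neg2-zero2 : ∀ w → (w +2 neg2 zero2) ≈2 w
  +2-neg2-zero2 (w₁ , w₂) = x-0≈x w₁ , x-0≈x w₂
    where
    x-0≈x : ∀ x → x + - 0# ≈ x
    x-0≈x x = trans (+-congˡ -0#≈0#) (+-identityʳ x)

  sub-add-cancel : ∀ w u → w ≈2 ((w +2 neg2 u) +2 u)
  sub-add-cancel (w₁ , w₂) (u₁ , u₂) = cancel w₁ u₁ , cancel w₂ u₂
    where
    cancel : ∀ w u → w ≈ (w + - u) + u
    cancel = solve 2 (λ w u → w := (w :+ :- u) :+ u) refl

  ·-identityˡ : ∀ u → (1# · u) ≈2 u
  ·-identityˡ (u₁ , u₂) = *-identityˡ u₁ , *-identityˡ u₂

  ·-zeroˡ : ∀ u → (0# · u) ≈2 zero2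
  ·-zeroˡ (u₁ , u₂) = zeroˡ u₁ , zeroˡ u₂

  ·-assoc : ∀ s t u → (s · (t · u)) ≈2 ((s * t) · u)
  ·-assoc s t (u₁ , u₂) = sym (*-assoc s t u₁) , sym (*-assoc s t u₂)

  ·-swap : ∀ s t u → (s · (t · u)) ≈2 (t · (s · u))
  ·-swap s t (u₁ , u₂) = swap u₁ , swap u₂
    where
    swap : ∀ x → s * (t * x) ≈ t * (s * x)
    swap = solve 3 (λ s t x → s :* (t :* x) := t :* (s :* x)) refl s t

  ·-distribˡ : ∀ t u w → ((t · u) +2 (t · w)) ≈2 (t · (u +2 w))
  ·-distribˡ t (u₁ , u₂) (w₁ , w₂) = sym (distribˡ t u₁ w₁) , sym (distribˡ t u₂ w₂)

  ·-neg2 : ∀ t u → neg2 (t · u) ≈2 (t · neg2 u)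
  ·-neg2 t (u₁ , u₂) = -‿distribʳ-* t u₁ , -‿distribʳ-* t u₂

  ·-inverse : ∀ {s t} → s * t ≈ 1# → ∀ u → (t · (s · u)) ≈2 u
  ·-inverse {s} {t} st≈1 u = begin
    t · (s · u)      ≈⟨ ·-assoc t s u ⟩
    (t * s) · u      ≈⟨ ·-cong (trans (*-comm t s) st≈1) ≈2-refl ⟩
    1# · u           ≈⟨ ·-identityˡ u ⟩
    u                ∎
    where open ≈2-Reasoning

  ·-cancel : ∀ {d u w} → ¬ (d ≈ 0#) → (d · u) ≈2 (d · w) → u ≈2 w
  ·-cancel {d} {u} {w} d≉0 du≈dw with inverse d d≉0
  ... | d⁻¹ , dd⁻¹≈1 = ≈2-trans (≈2-sym (·-inverse dd⁻¹≈1 u)) (≈2-trans (·-cong refl du≈dw) (·-inverse dd⁻¹≈1 w))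

  ⊙-· : ∀ g t u → (g ⊙ (t · u)) ≈2 (t · (g ⊙ u))
  ⊙-· (mat a b c′ d) t (u₁ , u₂) = row a b , row c′ d
    where
    row : ∀ a b → a * (t * u₁) + b * (t * u₂) ≈ t * (a * u₁ + b * u₂)
    row = solve 5 (λ t u₁ u₂ a b → a :* (t :* u₁) :+ b :* (t :* u₂) := t :* (a :* u₁ :+ b :* u₂)) refl t u₁ u₂

  ⊙-linear : ∀ g s t u w → (g ⊙ ((s · u) +2 (t · w))) ≈2 ((s · (g ⊙ u)) +2 (t · (g ⊙ w)))
  ⊙-linear (mat a b c′ d) s t (u₁ , u₂) (w₁ , w₂) = row a b , row c′ d
    where
    row : ∀ a b → a * (s * u₁ + t * w₁) + b * (s * u₂ + t * w₂) ≈ s * (a * u₁ + b * u₂) + t * (a * w₁ + b * w₂)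
    row = solve 8 (λ s t u₁ u₂ w₁ w₂ a b → a :* (s :* u₁ :+ t :* w₁) :+ b :* (s :* u₂ :+ t :* w₂)
                                          := s :* (a :* u₁ :+ b :* u₂) :+ t :* (a :* w₁ :+ b :* w₂))
                  refl s t u₁ u₂ w₁ w₂

  cayley-hamilton : ∀ g α β u → let w = (g ⊙ u) +2 neg2 (β · u) in
    ((g ⊙ w) +2 neg2 (α · w)) ≈2
      (((trace g + - (α + β)) · (g ⊙ u)) +2 neg2 ((det g + - (α * β)) · u))
  cayley-hamilton (mat a b c′ d) α β (u₁ , u₂) =
    solve 8 (λ a b c′ d α β u₁ u₂ →
        (a :* ((a :* u₁ :+ b :* u₂) :+ :- (β :* u₁)) :+ b :* ((c′ :* u₁ :+ d :* u₂) :+ :- (β :* u₂)))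
          :+ :- (α :* ((a :* u₁ :+ b :* u₂) :+ :- (β :* u₁)))
        := ((a :+ d) :+ :- (α :+ β)) :* (a :* u₁ :+ b :* u₂) :+ :- ((a :* d :+ :- (b :* c′) :+ :- (α :* β)) :* u₁))
      refl a b c′ d α β u₁ u₂ ,
    solve 8 (λ a b c′ d α β u₁ u₂ →
        (c′ :* ((a :* u₁ :+ b :* u₂) :+ :- (β :* u₁)) :+ d :* ((c′ :* u₁ :+ d :* u₂) :+ :- (β :* u₂)))
          :+ :- (α :* ((c′ :* u₁ :+ d :* u₂) :+ :- (β :* u₂)))
        := ((a :+ d) :+ :- (α :+ β)) :* (c′ :* u₁ :+ d :* u₂) :+ :- ((a :* d :+ :- (b :* c′) :+ :- (α :* β)) :* u₂))
      refl a b c′ d α β u₁ u₂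

  [_∣_] : K2 → K2 → Mat2
  [ (z₁ , z₂) ∣ (x₁ , x₂) ] = mat z₁ x₁ z₂ x₂

  columns-⊙ : ∀ z x a b → ([ z ∣ x ] ⊙ (a , b)) ≈2 ((a · z) +2 (b · x))
  columns-⊙ (z₁ , z₂) (x₁ , x₂) a b = row z₁ x₁ , row z₂ x₂
    where
    row : ∀ z x → z * a + x * b ≈ a * z + b * x
    row z x = +-cong (*-comm z a) (*-comm x b)

  det-subtract-column : ∀ z x t → det [ z +2 neg2 (t · x) ∣ x ] ≈ det [ z ∣ x ]
  det-subtract-column (z₁ , z₂) (x₁ , x₂) =
    solve 5 (λ z₁ z₂ x₁ x₂ t → (z₁ :+ :- (t :* x₁)) :* x₂ :+ :- (x₁ :* (z₂ :+ :- (t :* x₂)))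
                              := z₁ :* x₂ :+ :- (x₁ :* z₂))
      refl z₁ z₂ x₁ x₂

  adjugate : Mat2 → Mat2
  adjugate (mat a b c′ d) = mat d (- b) (- c′) a

  ⊙-adjugate : ∀ A s → (A ⊙ (adjugate A ⊙ s)) ≈2 (det A · s)
  ⊙-adjugate (mat a b c′ d) (s₁ , s₂) =
    solve 6 (λ a b c′ d s₁ s₂ → a :* (d :* s₁ :+ :- b :* s₂) :+ b :* (:- c′ :* s₁ :+ a :* s₂)
                                := (a :* d :+ :- (b :* c′)) :* s₁)
      refl a b c′ d s₁ s₂ ,
    solve 6 (λ a b c′ d s₁ s₂ → c′ :* (d :* s₁ :+ :- b :* s₂) :+ d :* (:- c′ :* s₁ :+ a :* s₂)
                                := (a :* d :+ :- (b :* c′)) :* s₂)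
      refl a b c′ d s₁ s₂

  adjugate-⊙ : ∀ A s → (adjugate A ⊙ (A ⊙ s)) ≈2 (det A · s)
  adjugate-⊙ (mat a b c′ d) (s₁ , s₂) =
    solve 6 (λ a b c′ d s₁ s₂ → d :* (a :* s₁ :+ b :* s₂) :+ :- b :* (c′ :* s₁ :+ d :* s₂)
                                := (a :* d :+ :- (b :* c′)) :* s₁)
      refl a b c′ d s₁ s₂ ,
    solve 6 (λ a b c′ d s₁ s₂ → :- c′ :* (a :* s₁ :+ b :* s₂) :+ a :* (c′ :* s₁ :+ d :* s₂)
                                := (a :* d :+ :- (b :* c′)) :* s₂)
      refl a b c′ d s₁ s₂

  module _ {A D} (detA*D≈1 : det A * D ≈ 1#) where

    ⊙-inverse : ∀ s → (A ⊙ (D · (adjugate A ⊙ s))) ≈2 s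
    ⊙-inverse s = begin
      A ⊙ (D · (adjugate A ⊙ s))   ≈⟨ ⊙-· A D (adjugate A ⊙ s) ⟩
      D · (A ⊙ (adjugate A ⊙ s))   ≈⟨ ·-cong refl (⊙-adjugate A s) ⟩
      D · (det A · s)              ≈⟨ ·-inverse detA*D≈1 s ⟩
      s                            ∎
      where open ≈2-Reasoning

    inverse-⊙ : ∀ s → (D · (adjugate A ⊙ (A ⊙ s))) ≈2 s
    inverse-⊙ s = ≈2-trans (·-cong refl (adjugate-⊙ A s)) (·-inverse detA*D≈1 s)

  -- Lattices in coordinates

  Integral : K2 → Set
  Integral (a , b) = O a × O b

  Integral-+2 : ∀ {u w} → Integral u → Integral w → Integral (u +2 w)
  Integral-+2 (Ou₁ , Ou₂) (Ow₁ , Ow₂) = vge-+ Ou₁ Ow₁ , vge-+ Ou₂ Ow₂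

  Integral-neg2 : ∀ {u} → Integral u → Integral (neg2 u)
  Integral-neg2 (Ou₁ , Ou₂) = vge-neg Ou₁ , vge-neg Ou₂

  Integral-· : ∀ {t u} → O t → Integral u → Integral (t · u)
  Integral-· Ot (Ou₁ , Ou₂) = vge-* Ot Ou₁ , vge-* Ot Ou₂

  Integral-⊙ : ∀ {A u} → IntegralMat A → Integral u → Integral (A ⊙ u)
  Integral-⊙ (Oa , Ob , Oc , Od) (Ou₁ , Ou₂) = vge-+ (vge-* Oa Ou₁) (vge-* Ob Ou₂) , vge-+ (vge-* Oc Ou₁) (vge-* Od Ou₂)

  IntegralMat-columns : ∀ {z x} → Integral z → Integral x → IntegralMat [ z ∣ x ]
  IntegralMat-columns (Oz₁ , Oz₂) (Ox₁ , Ox₂) = Oz₁ , Ox₁ , Oz₂ , Ox₂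

  IntegralMat-adjugate : ∀ {A} → IntegralMat A → IntegralMat (adjugate A)
  IntegralMat-adjugate (Oa , Ob , Oc , Od) = Od , vge-neg Ob , vge-neg Oc , Oa

  comb : Lattice → K2 → K2
  comb Λ (a , b) = (a · e₁ Λ) +2 (b · e₂ Λ)

  module _ (Λ : Lattice) where

    comb-cong : ∀ {u w} → u ≈2 w → comb Λ u ≈2 comb Λ w
    comb-cong (h₁ , h₂) = +2-cong (·-cong h₁ ≈2-refl) (·-cong h₂ ≈2-refl)

    comb-+2 : ∀ u w → (comb Λ u +2 comb Λ w) ≈2 comb Λ (u +2 w)
    comb-+2 (a , b) (a′ , b′) = row (proj₁ (e₁ Λ)) (proj₁ (e₂ Λ)) , row (proj₂ (e₁ Λ)) (proj₂ (e₂ Λ))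
      where
      row : ∀ e f → (a * e + b * f) + (a′ * e + b′ * f) ≈ (a + a′) * e + (b + b′) * f
      row = solve 6 (λ a b a′ b′ e f → (a :* e :+ b :* f) :+ (a′ :* e :+ b′ :* f) := (a :+ a′) :* e :+ (b :+ b′) :* f)
              refl a b a′ b′

    comb-· : ∀ t u → (t · comb Λ u) ≈2 comb Λ (t · u)
    comb-· t (a , b) = row (proj₁ (e₁ Λ)) (proj₁ (e₂ Λ)) , row (proj₂ (e₁ Λ)) (proj₂ (e₂ Λ))
      where
      row : ∀ e f → t * (a * e + b * f) ≈ (t * a) * e + (t * b) * f
      row = solve 5 (λ t a b e f → t :* (a :* e :+ b :* f) := (t :* a) :* e :+ (t :* b) :* f) refl t a b

    comb-neg2 : ∀ u → neg2 (comb Λ u) ≈2 comb Λ (neg2 u)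
    comb-neg2 (a , b) = row (proj₁ (e₁ Λ)) (proj₁ (e₂ Λ)) , row (proj₂ (e₁ Λ)) (proj₂ (e₂ Λ))
      where
      row : ∀ e f → - (a * e + b * f) ≈ (- a) * e + (- b) * f
      row = solve 4 (λ a b e f → :- (a :* e :+ b :* f) := (:- a) :* e :+ (:- b) :* f) refl a b

    comb-columns : ∀ z x a b → comb Λ ([ z ∣ x ] ⊙ (a , b)) ≈2 ((a · comb Λ z) +2 (b · comb Λ x))
    comb-columns z x a b = begin
      comb Λ ([ z ∣ x ] ⊙ (a , b))            ≈⟨ comb-cong (columns-⊙ z x a b) ⟩
      comb Λ ((a · z) +2 (b · x))             ≈⟨ comb-+2 (a · z) (b · x) ⟨
      comb Λ (a · z) +2 comb Λ (b · x)        ≈⟨ +2-cong (comb-· a z) (comb-· b x) ⟨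
      (a · comb Λ z) +2 (b · comb Λ x)        ∎
      where open ≈2-Reasoning

    comb-injective : ∀ {u w} → Integral u → Integral w → comb Λ u ≈2 comb Λ w → u ≈2 w
    comb-injective {u} {w} (Ou₁ , Ou₂) (Ow₁ , Ow₂) cu≈cw
      with free Λ _ _ (vge-+ Ou₁ (vge-neg Ow₁)) (vge-+ Ou₂ (vge-neg Ow₂)) difference≈0
      where
      difference≈0 : comb Λ (u +2 neg2 w) ≈2 zero2
      difference≈0 = begin
        comb Λ (u +2 neg2 w)                ≈⟨ comb-+2 u (neg2 w) ⟨
        comb Λ u +2 comb Λ (neg2 w)         ≈⟨ +2-cong cu≈cw (≈2-sym (comb-neg2 w)) ⟩
        comb Λ w +2 neg2 (comb Λ w)         ≈⟨ +2-inverseʳ (comb Λ w) ⟩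
        zero2                               ∎
        where open ≈2-Reasoning
    ... | d₁≈0 , d₂≈0 = x∙y⁻¹≈ε⇒x≈y _ _ d₁≈0 , x∙y⁻¹≈ε⇒x≈y _ _ d₂≈0

    mem-comb : ∀ {u} → Integral u → mem Λ (comb Λ u)
    mem-comb {a , b} (Oa , Ob) = gen⁻¹ Λ a b Oa Ob

    mem⇒comb : ∀ {w} → mem Λ w → ∃ λ u → Integral u × (w ≈2 comb Λ u)
    mem⇒comb {w} w∈Λ with gen Λ w w∈Λ
    ... | a , b , Oa , Ob , w≈ab = (a , b) , (Oa , Ob) , w≈ab

    e₁∈Λ : mem Λ (e₁ Λ)
    e₁∈Λ = resp Λ (row (proj₁ (e₁ Λ)) (proj₁ (e₂ Λ)) , row (proj₂ (e₁ Λ)) (proj₂ (e₂ Λ))) (mem-comb (O-1# , O-0#))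
      where
      row : ∀ e f → 1# * e + 0# * f ≈ e
      row = solve 2 (λ e f → con (+ 1) :* e :+ con (+ 0) :* f := e) refl

    e₂∈Λ : mem Λ (e₂ Λ)
    e₂∈Λ = resp Λ (row (proj₁ (e₁ Λ)) (proj₁ (e₂ Λ)) , row (proj₂ (e₁ Λ)) (proj₂ (e₂ Λ))) (mem-comb (O-0# , O-1#))
      where
      row : ∀ e f → 0# * e + 1# * f ≈ f
      row = solve 2 (λ e f → con (+ 0) :* e :+ con (+ 1) :* f := f) refl

    mem-+2 : ∀ {u w} → mem Λ u → mem Λ w → mem Λ (u +2 w)
    mem-+2 u∈Λ w∈Λ with mem⇒comb u∈Λ | mem⇒comb w∈Λ
    ... | a , Oa , u≈a | b , Ob , w≈b =
      resp Λ (≈2-sym (≈2-trans (+2-cong u≈a w≈b) (comb-+2 a b))) (mem-comb (Integral-+2 Oa Ob))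

    mem-neg2 : ∀ {u} → mem Λ u → mem Λ (neg2 u)
    mem-neg2 u∈Λ with mem⇒comb u∈Λ
    ... | a , Oa , u≈a = resp Λ (≈2-sym (≈2-trans (neg2-cong u≈a) (comb-neg2 a))) (mem-comb (Integral-neg2 Oa))

    mem-· : ∀ {t u} → O t → mem Λ u → mem Λ (t · u)
    mem-· {t} Ot u∈Λ with mem⇒comb u∈Λ
    ... | a , Oa , u≈a = resp Λ (≈2-sym (≈2-trans (·-cong refl u≈a) (comb-· t a))) (mem-comb (Integral-· Ot Oa))

    ∈·-resp : ∀ {t w w′} → w ≈2 w′ → w ∈[ t · Λ ] → w′ ∈[ t · Λ ]
    ∈·-resp w≈w′ (u , u∈Λ , w≈tu) = u , u∈Λ , ≈2-trans (≈2-sym w≈w′) w≈tu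

    ∈·-+2 : ∀ {t w w′} → w ∈[ t · Λ ] → w′ ∈[ t · Λ ] → (w +2 w′) ∈[ t · Λ ]
    ∈·-+2 {t} (u , u∈Λ , w≈tu) (u′ , u′∈Λ , w′≈tu′) =
      u +2 u′ , mem-+2 u∈Λ u′∈Λ , ≈2-trans (+2-cong w≈tu w′≈tu′) (·-distribˡ t u u′)

    ∈·-neg2 : ∀ {t w} → w ∈[ t · Λ ] → neg2 w ∈[ t · Λ ]
    ∈·-neg2 {t} (u , u∈Λ , w≈tu) = neg2 u , mem-neg2 u∈Λ , ≈2-trans (neg2-cong w≈tu) (·-neg2 t u)

    vge-·-∈π^ : ∀ n {t u} → vge t (+ n) → mem Λ u → (t · u) ∈[ (π ^ n) · Λ ]
    vge-·-∈π^ n {t} {u} t≥n u∈Λ with vge⇒π^-* n t≥n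
    ... | e , Oe , t≈π^e = e · u , mem-· Oe u∈Λ , ≈2-trans (·-cong t≈π^e ≈2-refl) (≈2-sym (·-assoc (π ^ n) e u))

    ≈2⇒≡mod : ∀ n {w w′} → w ≈2 w′ → w ≡[ Λ mod n ] w′
    ≈2⇒≡mod n {w} {w′} w≈w′ =
      ∈·-resp (≈2-trans (·-zeroˡ (e₁ Λ)) (≈2-sym (≈2-trans (+2-cong w≈w′ ≈2-refl) (+2-inverseʳ w′))))
        (vge-·-∈π^ n (vge-zero refl) e₁∈Λ)

  π^·⇒≡0 : ∀ n {a b e} → Integral e → (a , b) ≈2 ((π ^ n) · e) → (a ≡[mod n ] 0#) × (b ≡[mod n ] 0#)
  π^·⇒≡0 n {a} {b} (Oe₁ , Oe₂) (a≈π^e₁ , b≈π^e₂) =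
    vge-resp (sym (trans (+-congˡ -0#≈0#) (trans (+-identityʳ a) a≈π^e₁))) (vge-π^-* n Oe₁) ,
    vge-resp (sym (trans (+-congˡ -0#≈0#) (trans (+-identityʳ b) b≈π^e₂))) (vge-π^-* n Oe₂)

  unimodular⇒QuotBasis : ∀ Λ n {z x v₁ v₂} → Integral z → Integral x → Unit (det [ z ∣ x ]) →
    v₁ ≈2 comb Λ z → v₂ ≈2 comb Λ x → QuotBasis Λ n v₁ v₂
  unimodular⇒QuotBasis Λ n {z} {x} {v₁} {v₂} Oz Ox Δ-unit v₁≈z v₂≈x =
    resp Λ (≈2-sym v₁≈z) (mem-comb Λ Oz) , resp Λ (≈2-sym v₂≈x) (mem-comb Λ Ox) , spans , independent
    where
    open ≈2-Reasoning
    A : Mat2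
    A = [ z ∣ x ]

    OA⁻¹ : IntegralMat (adjugate A)
    OA⁻¹ = IntegralMat-adjugate (IntegralMat-columns Oz Ox)

    D : K
    D = proj₁ (Unit⇒inverse Δ-unit)

    OD : O D
    OD = proj₁ (proj₂ (Unit⇒inverse Δ-unit))

    ΔD≈1 : det A * D ≈ 1#
    ΔD≈1 = proj₂ (proj₂ (Unit⇒inverse Δ-unit))

    combination : ∀ a b → comb Λ (A ⊙ (a , b)) ≈2 ((a · v₁) +2 (b · v₂))
    combination a b = ≈2-trans (comb-columns Λ z x a b)
      (+2-cong (·-cong refl (≈2-sym v₁≈z)) (·-cong refl (≈2-sym v₂≈x)))

    spans : ∀ w → mem Λ w → ∃ λ a → ∃ λ b → O a × O b × (w ≡[ Λ mod n ] ((a · v₁) +2 (b · v₂)))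
    spans w w∈Λ with mem⇒comb Λ w∈Λ
    ... | s , Os , w≈s = proj₁ u , proj₂ u , proj₁ Ou , proj₂ Ou , ≈2⇒≡mod Λ n w≈combination
      where
      u : K2
      u = D · (adjugate A ⊙ s)
      Ou : Integral u
      Ou = Integral-· OD (Integral-⊙ OA⁻¹ Os)
      w≈combination : w ≈2 ((proj₁ u · v₁) +2 (proj₂ u · v₂))
      w≈combination = begin
        w                                  ≈⟨ w≈s ⟩
        comb Λ s                           ≈⟨ comb-cong Λ (⊙-inverse ΔD≈1 s) ⟨
        comb Λ (A ⊙ u)                     ≈⟨ combination (proj₁ u) (proj₂ u) ⟩
        (proj₁ u · v₁) +2 (proj₂ u · v₂)   ∎

    independent : ∀ a b → O a → O b → (((a · v₁) +2 (b · v₂)) ≡[ Λ mod n ] zero2) →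
      (a ≡[mod n ] 0#) × (b ≡[mod n ] 0#)
    independent a b Oa Ob (m , m∈Λ , ab≈π^m) with mem⇒comb Λ m∈Λ
    ... | c , Oc , m≈c = π^·⇒≡0 n (Integral-· OD (Integral-⊙ OA⁻¹ Oc)) (begin
        (a , b)                                    ≈⟨ inverse-⊙ ΔD≈1 (a , b) ⟨
        D · (adjugate A ⊙ (A ⊙ (a , b)))           ≈⟨ ·-cong refl (⊙-congʳ (adjugate A) A[ab]≈π^c) ⟩
        D · (adjugate A ⊙ ((π ^ n) · c))           ≈⟨ ·-cong refl (⊙-· (adjugate A) (π ^ n) c) ⟩
        D · ((π ^ n) · (adjugate A ⊙ c))           ≈⟨ ·-swap D (π ^ n) (adjugate A ⊙ c) ⟩
        (π ^ n) · (D · (adjugate A ⊙ c))           ∎)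
      where
      A[ab]≈π^c : (A ⊙ (a , b)) ≈2 ((π ^ n) · c)
      A[ab]≈π^c = comb-injective Λ (Integral-⊙ (IntegralMat-columns Oz Ox) (Oa , Ob)) (Integral-· (O-π^ n) Oc) (begin
        comb Λ (A ⊙ (a , b))                       ≈⟨ combination a b ⟩
        (a · v₁) +2 (b · v₂)                       ≈⟨ +2-neg2-zero2 _ ⟨
        ((a · v₁) +2 (b · v₂)) +2 neg2 zero2       ≈⟨ ab≈π^m ⟩
        (π ^ n) · m                                ≈⟨ ·-cong refl m≈c ⟩
        (π ^ n) · comb Λ c                         ≈⟨ comb-· Λ (π ^ n) c ⟩
        comb Λ ((π ^ n) · c)                       ∎)

  Represents : Mat2 → Mat2 → Lattice → Set (c ⊔ ℓ)
  Represents G g Λ = ∀ u → (g ⊙ comb Λ u) ≈2 comb Λ (G ⊙ u)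

  matrix-in-basis : ∀ {g} Λ → InX g Λ → ∃ λ G → IntegralMat G × Represents G g Λ
  matrix-in-basis {g} Λ gΛ⊆Λ with mem⇒comb Λ (gΛ⊆Λ _ (e₁∈Λ Λ)) | mem⇒comb Λ (gΛ⊆Λ _ (e₂∈Λ Λ))
  ... | x , Ox , ge₁≈x | y , Oy , ge₂≈y = [ x ∣ y ] , IntegralMat-columns Ox Oy , g-comb
    where
    g-comb : ∀ u → (g ⊙ comb Λ u) ≈2 comb Λ ([ x ∣ y ] ⊙ u)
    g-comb (a , b) = begin
      g ⊙ comb Λ (a , b)                            ≈⟨ ⊙-linear g a b (e₁ Λ) (e₂ Λ) ⟩
      (a · (g ⊙ e₁ Λ)) +2 (b · (g ⊙ e₂ Λ))          ≈⟨ +2-cong (·-cong refl ge₁≈x) (·-cong refl ge₂≈y) ⟩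
      (a · comb Λ x) +2 (b · comb Λ y)              ≈⟨ comb-columns Λ x y a b ⟨
      comb Λ ([ x ∣ y ] ⊙ (a , b))                  ∎
      where open ≈2-Reasoning

  represents-sub-scalar : ∀ {G g Λ} → Represents G g Λ → ∀ β x →
    ((g ⊙ comb Λ x) +2 neg2 (β · comb Λ x)) ≈2 comb Λ ((G ⊙ x) +2 neg2 (β · x))
  represents-sub-scalar {G} {g} {Λ} G-represents β x = begin
    (g ⊙ comb Λ x) +2 neg2 (β · comb Λ x)         ≈⟨ +2-cong (G-represents x) (neg2-cong (comb-· Λ β x)) ⟩
    comb Λ (G ⊙ x) +2 neg2 (comb Λ (β · x))       ≈⟨ +2-cong ≈2-refl (comb-neg2 Λ (β · x)) ⟩
    comb Λ (G ⊙ x) +2 comb Λ (neg2 (β · x))       ≈⟨ comb-+2 Λ (G ⊙ x) (neg2 (β · x)) ⟩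
    comb Λ ((G ⊙ x) +2 neg2 (β · x))              ∎
    where open ≈2-Reasoning

  -- Boundary points

  ScalarModπOn : Mat2 → Lattice → K → Set (c ⊔ ℓ)
  ScalarModπOn g Λ p = ∀ w → mem Λ w → ∃ λ w′ → mem Λ w′ × ((g ⊙ w) ≈2 ((p · w) +2 (π · w′)))

  homothetic-InX : ∀ {g Λ M t} → InX g Λ → Sub 1# M t Λ → Sub t Λ 1# M → InX g M
  homothetic-InX {g} {Λ} {M} {t} gΛ⊆Λ M⊆tΛ tΛ⊆M w w∈M with M⊆tΛ w (w , w∈M , ≈2-sym (·-identityˡ w))
  ... | u , u∈Λ , w≈tu with tΛ⊆M (g ⊙ w) (g ⊙ u , gΛ⊆Λ u u∈Λ , ≈2-trans (⊙-congʳ g w≈tu) (⊙-· g t u))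
  ...   | m , m∈M , gw≈m = resp M (≈2-sym (≈2-trans gw≈m (·-identityˡ m))) m∈M

  adjacent-InX : ∀ {g Λ M p} → O p → ScalarModπOn g Λ p → Adjacent Λ M → InX g M
  adjacent-InX {g} {Λ} {M} {p} Op scalar (c₀ , d₀ , _ , d₀≉0 , (πc₀Λ⊆d₀M , _) , (d₀M⊆c₀Λ , _)) w w∈M
    with d₀M⊆c₀Λ (d₀ · w) (w , w∈M , ≈2-refl)
  ... | u , u∈Λ , d₀w≈c₀u with scalar u u∈Λ
  ...   | u′ , u′∈Λ , gu≈pu+πu′ with πc₀Λ⊆d₀M ((π * c₀) · u′) (u′ , u′∈Λ , ≈2-refl)
  ...     | m′ , m′∈M , πc₀u′≈d₀m′ =
    resp M (≈2-sym (·-cancel d₀≉0 d₀gw≈d₀[pw+m′])) (mem-+2 M (mem-· M Op w∈M) m′∈M)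
    where
    open ≈2-Reasoning
    d₀gw≈d₀[pw+m′] : (d₀ · (g ⊙ w)) ≈2 (d₀ · ((p · w) +2 m′))
    d₀gw≈d₀[pw+m′] = begin
      d₀ · (g ⊙ w)                            ≈⟨ ⊙-· g d₀ w ⟨
      g ⊙ (d₀ · w)                            ≈⟨ ⊙-congʳ g d₀w≈c₀u ⟩
      g ⊙ (c₀ · u)                            ≈⟨ ⊙-· g c₀ u ⟩
      c₀ · (g ⊙ u)                            ≈⟨ ·-cong refl gu≈pu+πu′ ⟩
      c₀ · ((p · u) +2 (π · u′))              ≈⟨ ·-distribˡ c₀ (p · u) (π · u′) ⟨
      (c₀ · (p · u)) +2 (c₀ · (π · u′))       ≈⟨ +2-cong (·-swap c₀ p u) (·-swap c₀ π u′) ⟩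
      (p · (c₀ · u)) +2 (π · (c₀ · u′))       ≈⟨ +2-cong (·-cong refl (≈2-sym d₀w≈c₀u)) (·-assoc π c₀ u′) ⟩
      (p · (d₀ · w)) +2 ((π * c₀) · u′)       ≈⟨ +2-cong (·-swap p d₀ w) πc₀u′≈d₀m′ ⟩
      (d₀ · (p · w)) +2 (d₀ · m′)             ≈⟨ ·-distribˡ d₀ (p · w) m′ ⟩
      d₀ · ((p · w) +2 m′)                    ∎

  boundary⇒¬ScalarModπOn : ∀ {g Λ p} → BoundaryPoint g Λ → O p → ¬ ScalarModπOn g Λ p
  boundary⇒¬ScalarModπOn {g} {Λ} (gΛ⊆Λ , M , inj₁ (t , _ , M⊆tΛ , tΛ⊆M) , gM⊈M) _ _ =
    gM⊈M (homothetic-InX {g} {Λ} {M} {t} gΛ⊆Λ M⊆tΛ tΛ⊆M)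
  boundary⇒¬ScalarModπOn {g} {Λ} {p} (_ , M , inj₂ Λ∼M , gM⊈M) Op scalar =
    gM⊈M (adjacent-InX {g} {Λ} {M} {p} Op scalar Λ∼M)

  ScalarModπ : Mat2 → Set
  ScalarModπ (mat p q r s) = vge q (+ 1) × vge r (+ 1) × vge (p + - s) (+ 1)

  ScalarModπ⇒decomposition : ∀ {p q r s} → ScalarModπ (mat p q r s) →
    ∃ λ H → IntegralMat H × (∀ u → (mat p q r s ⊙ u) ≈2 ((p · u) +2 (π · (H ⊙ u))))
  ScalarModπ⇒decomposition {p} {q} {r} {s} (q≥1 , r≥1 , p-s≥1)
    with vge⇒π^-* 1 q≥1 | vge⇒π^-* 1 r≥1 | vge⇒π^-* 1 p-s≥1
  ... | q₀ , Oq₀ , q≈πq₀ | r₀ , Or₀ , r≈πr₀ | t₀ , Ot₀ , p-s≈πt₀ =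
    mat 0# q₀ r₀ (- t₀) , (O-0# , Oq₀ , Or₀ , vge-neg Ot₀) , decompose
    where
    s≈p-πt₀ : s ≈ p + - ((π * 1#) * t₀)
    s≈p-πt₀ = trans (solve 2 (λ p s → s := p :+ :- (p :+ :- s)) refl p s) (+-congˡ (-‿cong p-s≈πt₀))

    decompose : ∀ u → (mat p q r s ⊙ u) ≈2 ((p · u) +2 (π · (mat 0# q₀ r₀ (- t₀) ⊙ u)))
    decompose (u₁ , u₂) =
      trans (+-congˡ (*-congʳ q≈πq₀))
        (solve 5 (λ π p q₀ u₁ u₂ → p :* u₁ :+ ((π :* con (+ 1)) :* q₀) :* u₂
                                   := p :* u₁ :+ π :* (con (+ 0) :* u₁ :+ q₀ :* u₂))
           refl π p q₀ u₁ u₂) ,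
      trans (+-cong (*-congʳ r≈πr₀) (*-congʳ s≈p-πt₀))
        (solve 6 (λ π p r₀ t₀ u₁ u₂ → ((π :* con (+ 1)) :* r₀) :* u₁ :+ (p :+ :- ((π :* con (+ 1)) :* t₀)) :* u₂
                                      := p :* u₂ :+ π :* (r₀ :* u₁ :+ (:- t₀) :* u₂))
           refl π p r₀ t₀ u₁ u₂)

  boundary⇒¬ScalarModπ : ∀ {g Λ G} → BoundaryPoint g Λ → IntegralMat G → Represents G g Λ → ¬ ScalarModπ G
  boundary⇒¬ScalarModπ {g} {Λ} {mat p q r s} boundary (Op , _) G-represents scalar =
    boundary⇒¬ScalarModπOn {g} {Λ} {p} boundary Op g-scalar
    where
    g-scalar : ScalarModπOn g Λ p
    g-scalar w w∈Λ with mem⇒comb Λ w∈Λ | ScalarModπ⇒decomposition scalar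
    ... | a , Oa , w≈a | H , OH , G≈p+πH = comb Λ (H ⊙ a) , mem-comb Λ (Integral-⊙ OH Oa) , (begin
      g ⊙ w                                      ≈⟨ ⊙-congʳ g w≈a ⟩
      g ⊙ comb Λ a                               ≈⟨ G-represents a ⟩
      comb Λ (mat p q r s ⊙ a)                   ≈⟨ comb-cong Λ (G≈p+πH a) ⟩
      comb Λ ((p · a) +2 (π · (H ⊙ a)))          ≈⟨ comb-+2 Λ (p · a) (π · (H ⊙ a)) ⟨
      comb Λ (p · a) +2 comb Λ (π · (H ⊙ a))     ≈⟨ +2-cong (comb-· Λ p a) (comb-· Λ π (H ⊙ a)) ⟨
      (p · comb Λ a) +2 (π · comb Λ (H ⊙ a))     ≈⟨ +2-cong (·-cong refl (≈2-sym w≈a)) ≈2-refl ⟩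
      (p · w) +2 (π · comb Λ (H ⊙ a))            ∎)
      where open ≈2-Reasoning

  -- Cyclic vectors

  module _ (p q r s : K) where

    det-e₁ : det [ mat p q r s ⊙ (1# , 0#) ∣ (1# , 0#) ] ≈ - r
    det-e₁ = solve 4 (λ p q r s → (p :* con (+ 1) :+ q :* con (+ 0)) :* con (+ 0)
                                    :+ :- (con (+ 1) :* (r :* con (+ 1) :+ s :* con (+ 0)))
                                  := :- r) refl p q r s

    det-e₂ : det [ mat p q r s ⊙ (0# , 1#) ∣ (0# , 1#) ] ≈ q
    det-e₂ = solve 4 (λ p q r s → (p :* con (+ 0) :+ q :* con (+ 1)) :* con (+ 1)
                                    :+ :- (con (+ 0) :* (r :* con (+ 0) :+ s :* con (+ 1)))
                                  := q) refl p q r s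

    det-e₁+e₂ : det [ mat p q r s ⊙ (1# , 1#) ∣ (1# , 1#) ] ≈ (p + - s) + (q + - r)
    det-e₁+e₂ = solve 4 (λ p q r s → (p :* con (+ 1) :+ q :* con (+ 1)) :* con (+ 1)
                                       :+ :- (con (+ 1) :* (r :* con (+ 1) :+ s :* con (+ 1)))
                                     := (p :+ :- s) :+ (q :+ :- r)) refl p q r s

  ScalarModπ⊎cyclic : ∀ {G} → IntegralMat G → ScalarModπ G ⊎ ∃ λ x → Integral x × Unit (det [ G ⊙ x ∣ x ])
  ScalarModπ⊎cyclic {mat p q r s} (Op , Oq , Or , Os) with O⇒vge1⊎Unit Or
  ... | inj₂ r-unit = inj₂ ((1# , 0#) , (O-1# , O-0#) , Unit-resp (sym (det-e₁ p q r s)) (Unit-neg r-unit))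
  ... | inj₁ r≥1 with O⇒vge1⊎Unit Oq
  ...   | inj₂ q-unit = inj₂ ((0# , 1#) , (O-0# , O-1#) , Unit-resp (sym (det-e₂ p q r s)) q-unit)
  ...   | inj₁ q≥1 with O⇒vge1⊎Unit (vge-+ Op (vge-neg Os))
  ...     | inj₁ p-s≥1 = inj₁ (q≥1 , r≥1 , p-s≥1)
  ...     | inj₂ p-s-unit = inj₂ ((1# , 1#) , (O-1# , O-1#) ,
          Unit-resp (sym (det-e₁+e₂ p q r s)) (Unit-+-vge1 p-s-unit (vge-+ q≥1 (vge-neg r≥1))))

lemma2p20 : ∀ {c ℓ : Level} (F : CDVF c ℓ) → let open Notions F in
    (g : Mat2) → IntegralMat g → (Λ : Lattice) → BoundaryPoint g Λ →
    (n : ℕ) → 1 ℕ.≤ n → (α β : K) → O α → O β →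
    (trace g ≡[mod n ] (α + β)) → (det g ≡[mod n ] (α * β)) →
    ∃ λ v₁ → ∃ λ v₂ → QuotBasis Λ n v₁ v₂ ×
      ((g ⊙ v₁) ≡[ Λ mod n ] (α · v₁)) ×
      ((g ⊙ v₂) ≡[ Λ mod n ] (v₁ +2 (β · v₂)))
lemma2p20 F g _ Λ boundary n _ α β _ Oβ tr≡α+β det≡αβ with matrix-in-basis F {g} Λ (proj₁ boundary)
... | G , OG , G-represents with ScalarModπ⊎cyclic F OG
...   | inj₁ scalar = ⊥-elim (boundary⇒¬ScalarModπ F {g} {Λ} {G} boundary OG G-represents scalar)
...   | inj₂ (x , Ox , Δ-unit) = v₁ , v₂ , basis , eigenvector , v₂↦v₁+βv₂
  where
  open Notions F
  v₂ v₁ : K2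
  v₂ = comb F Λ x
  v₁ = (g ⊙ v₂) +2 neg2 (β · v₂)

  v₂∈Λ : mem Λ v₂
  v₂∈Λ = mem-comb F Λ Ox

  basis : QuotBasis Λ n v₁ v₂
  basis = unimodular⇒QuotBasis F Λ n
    (Integral-+2 F (Integral-⊙ F OG Ox) (Integral-neg2 F (Integral-· F Oβ Ox)))
    Ox (Unit-resp F (sym (det-subtract-column F (G ⊙ x) x β)) Δ-unit)
    (represents-sub-scalar F {G} {g} {Λ} G-represents β x) (≈2-refl F {v₂})

  eigenvector : (g ⊙ v₁) ≡[ Λ mod n ] (α · v₁)
  eigenvector = ∈·-resp F Λ (≈2-sym F (cayley-hamilton F g α β v₂))
    (∈·-+2 F Λ (vge-·-∈π^ F Λ n tr≡α+β (proj₁ boundary v₂ v₂∈Λ))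
                (∈·-neg2 F Λ (vge-·-∈π^ F Λ n det≡αβ v₂∈Λ)))

  v₂↦v₁+βv₂ : (g ⊙ v₂) ≡[ Λ mod n ] (v₁ +2 (β · v₂))
  v₂↦v₁+βv₂ = ≈2⇒≡mod F Λ n (sub-add-cancel F (g ⊙ v₂) (β · v₂))
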